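{- Let $G$ be a simple graph of order $n\ge2$, and let $ij, lk\in E(G)$ with $\{i,j\}\ne\{l,k\}$. The contracted vertices $\{i,j\}_2$ and $\{l,k\}_2$ are adjacent in $S[G,2]$ if and only if $|\{i,j\}\cap\{l,k\}|=1$ and the subgraph of $G$ induced on the $3$-element set $\{i,j,k,l\}$ is a triangle.
   Context: Let $G$ be a simple graph with vertex set $V=\{1,\dots,n\}$, $n\ge 2$. The generalized Sierpiński graph $S(G,2)$ has vertex set $V^2$ (words $u_1u_2$); $u_1u_2$ and $v_1v_2$ are adjacent iff either $u_1=v_1$ and $u_2v_2\in E(G)$, or $u_1\ne v_1$, $u_1v_1\in E(G)$, $u_2=v_1$ and $v_2=u_1$. The edges of the second kind (joining $ab$ and $ba$ for $ab\in E(G)$) are the linking edges. The generalized Sierpiński gasket $S[G,2]$ is obtained from $S(G,2)$ by contracting all linking edges; the vertex obtained by contracting the edge between $ab$ and $ba$ is called a contracted vertex and denoted $\{a,b\}_2$. -}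

module Defs where

open import Data.Nat using (ℕ)
open import Data.Fin using (Fin)
open import Data.Product using (_×_; _,_; ∃; ∃-syntax)
open import Data.Sum using (_⊎_)
open import Relation.Binary.PropositionalEquality using (_≡_; _≢_)
open import Relation.Nullary using (¬_)

record SimpleGraph (n : ℕ) : Set₁ where
  field
    Adj    : Fin n → Fin n → Set
    sym    : ∀ {x y} → Adj x y → Adj y x
    irrefl : ∀ {x} → ¬ Adj x x

open SimpleGraph public

Word : ℕ → Set
Word n = Fin n × Fin n

-- Adjacency in the generalized Sierpiński graph S(G,2).
SAdj : ∀ {n} → SimpleGraph n → Word n → Word n → Set
SAdj G (u₁ , u₂) (v₁ , v₂) =
  (u₁ ≡ v₁ × Adj G u₂ v₂)
  ⊎ (u₁ ≢ v₁ × Adj G u₁ v₁ × u₂ ≡ v₁ × v₂ ≡ u₁)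

Linking : ∀ {n} → SimpleGraph n → Word n → Word n → Set
Linking G (a , b) (c , d) = Adj G a b × c ≡ b × d ≡ a

-- Two words are identified in S[G,2] iff equal or joined by a linking edge
-- (linking edges form a matching, so this is the contraction equivalence).
Merged : ∀ {n} → SimpleGraph n → Word n → Word n → Set
Merged G u v = u ≡ v ⊎ Linking G u v

-- Adjacency in the gasket S[G,2], on representative words: the contracted
-- vertices are distinct and some members are adjacent in S(G,2).
GasketAdj : ∀ {n} → SimpleGraph n → Word n → Word n → Set
GasketAdj G x y =
  ¬ Merged G x y × ∃[ u ] ∃[ v ] (Merged G x u × Merged G y v × SAdj G u v)

contracted : ∀ {n} → Fin n → Fin n → Word n
contracted a b = (a , b)

SamePair : ∀ {n} → Fin n → Fin n → Fin n → Fin n → Set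
SamePair i j l k = (i ≡ l × j ≡ k) ⊎ (i ≡ k × j ≡ l)

_∈₂_,_ : ∀ {n} → Fin n → Fin n → Fin n → Set
x ∈₂ a , b = x ≡ a ⊎ x ≡ b

MeetInOne : ∀ {n} → Fin n → Fin n → Fin n → Fin n → Set
MeetInOne i j l k =
  ∃[ c ] ((c ∈₂ i , j) × (c ∈₂ l , k)
          × (∀ c' → (c' ∈₂ i , j) → (c' ∈₂ l , k) → c' ≡ c))

In4 : ∀ {n} → Fin n → Fin n → Fin n → Fin n → Fin n → Set
In4 i j l k x = x ≡ i ⊎ x ≡ j ⊎ x ≡ l ⊎ x ≡ k

-- The subgraph of G induced on {i,j,l,k} is complete (a triangle when the set has 3 elements).
InducedComplete : ∀ {n} → SimpleGraph n → Fin n → Fin n → Fin n → Fin n → Set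
InducedComplete G i j l k =
  ∀ x y → In4 i j l k x → In4 i j l k y → x ≢ y → Adj G x y

{-# OPTIONS --safe #-}
-- The contracted vertex {i,j}₂ gathers the words ij and ji. A linking edge between
-- a word of {i,j}₂ and one of {l,k}₂ would force {i,j} = {l,k}, so every S(G,2)-edge
-- between the two classes lies inside a copy: ab — ad with bd ∈ E(G). Hence the pairs
-- share exactly the vertex a and {a,b,d} spans a triangle. Conversely, orienting both
-- pairs so that their common vertex comes first yields such an edge.
module Submission where

open import Defs
open import Data.Nat using (ℕ; _≤_)
open import Data.Fin using (Fin)
open import Data.Product using (_×_; _,_; ∃-syntax)
open import Data.Sum using (_⊎_; inj₁; inj₂; [_,_]′)
import Data.Sum as Sum
open import Data.Empty using (⊥-elim)
open import Function.Base using (id; _∘_)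
open import Function.Bundles using (_⇔_; mk⇔)
open import Relation.Nullary using (¬_)
open import Relation.Binary.PropositionalEquality using (_≡_; refl; _≢_)
import Relation.Binary.PropositionalEquality as ≡

private
  variable
    n : ℕ
    a b c d i j l k x : Fin n

SamePair-sym : SamePair i j a b → SamePair a b i j
SamePair-sym (inj₁ (refl , refl)) = inj₁ (refl , refl)
SamePair-sym (inj₂ (refl , refl)) = inj₂ (refl , refl)

SamePair-trans : SamePair i j a b → SamePair a b l k → SamePair i j l k
SamePair-trans (inj₁ (refl , refl)) q = q
SamePair-trans (inj₂ (refl , refl)) (inj₁ (refl , refl)) = inj₂ (refl , refl)
SamePair-trans (inj₂ (refl , refl)) (inj₂ (refl , refl)) = inj₁ (refl , refl)

SamePair-swap : SamePair a b b a
SamePair-swap = inj₂ (refl , refl)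

∈₂-resp-SamePair : SamePair i j a b → x ∈₂ a , b → x ∈₂ i , j
∈₂-resp-SamePair (inj₁ (refl , refl)) = id
∈₂-resp-SamePair (inj₂ (refl , refl)) = Sum.swap

∈₂⇒SamePair : c ∈₂ i , j → ∃[ b ] SamePair i j c b
∈₂⇒SamePair (inj₁ refl) = _ , inj₁ (refl , refl)
∈₂⇒SamePair (inj₂ refl) = _ , inj₂ (refl , refl)

In4-split : In4 a b c d x → x ∈₂ a , b ⊎ x ∈₂ c , d
In4-split (inj₁ p)               = inj₁ (inj₁ p)
In4-split (inj₂ (inj₁ p))        = inj₁ (inj₂ p)
In4-split (inj₂ (inj₂ (inj₁ p))) = inj₂ (inj₁ p)
In4-split (inj₂ (inj₂ (inj₂ p))) = inj₂ (inj₂ p)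

In4-join : x ∈₂ a , b ⊎ x ∈₂ c , d → In4 a b c d x
In4-join (inj₁ (inj₁ p)) = inj₁ p
In4-join (inj₁ (inj₂ p)) = inj₂ (inj₁ p)
In4-join (inj₂ (inj₁ p)) = inj₂ (inj₂ (inj₁ p))
In4-join (inj₂ (inj₂ p)) = inj₂ (inj₂ (inj₂ p))

In4-resp-SamePair : SamePair i j a b → SamePair l k c d → In4 a b c d x → In4 i j l k x
In4-resp-SamePair p q =
  In4-join ∘ Sum.map (∈₂-resp-SamePair p) (∈₂-resp-SamePair q) ∘ In4-split

MeetInOne-resp-SamePair : SamePair i j a b → SamePair l k c d
                        → MeetInOne a b c d → MeetInOne i j l k
MeetInOne-resp-SamePair p q (e , e∈ab , e∈cd , unique) =
  e , ∈₂-resp-SamePair p e∈ab , ∈₂-resp-SamePair q e∈cd ,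
  λ e' e'∈ij e'∈lk → unique e' (∈₂-resp-SamePair (SamePair-sym p) e'∈ij)
                               (∈₂-resp-SamePair (SamePair-sym q) e'∈lk)

MeetInOne-shared : b ≢ d → MeetInOne a b a d
MeetInOne-shared {b = b} {d = d} {a = a} b≢d = a , inj₁ refl , inj₁ refl , unique
  where
  unique : ∀ e → e ∈₂ a , b → e ∈₂ a , d → e ≡ a
  unique e (inj₁ e≡a) _           = e≡a
  unique e (inj₂ _)    (inj₁ e≡a)  = e≡a
  unique e (inj₂ refl) (inj₂ refl) = ⊥-elim (b≢d refl)

module _ (G : SimpleGraph n) where

  Adj⇒≢ : Adj G a b → a ≢ b
  Adj⇒≢ ab refl = irrefl G ab

  Adj-resp-SamePair : SamePair i j a b → Adj G i j → Adj G a b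
  Adj-resp-SamePair (inj₁ (refl , refl)) = id
  Adj-resp-SamePair (inj₂ (refl , refl)) = sym G

  InducedComplete-resp-SamePair : SamePair i j a b → SamePair l k c d
                                → InducedComplete G a b c d → InducedComplete G i j l k
  InducedComplete-resp-SamePair p q complete x y x∈ y∈ =
    complete x y (In4-resp-SamePair (SamePair-sym p) (SamePair-sym q) x∈)
                 (In4-resp-SamePair (SamePair-sym p) (SamePair-sym q) y∈)

  InducedComplete-triangle : Adj G a b → Adj G a d → Adj G b d → InducedComplete G a b a d
  InducedComplete-triangle {a = a} {b = b} {d = d} ab ad bd x y x∈ y∈ =
    adjacent (triangle (In4-split x∈)) (triangle (In4-split y∈))
    where
    Triangle : Fin _ → Set
    Triangle z = z ≡ a ⊎ z ≡ b ⊎ z ≡ d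

    triangle : ∀ {z} → z ∈₂ a , b ⊎ z ∈₂ a , d → Triangle z
    triangle = [ Sum.map₂ inj₁ , Sum.map₂ inj₂ ]′

    adjacent : ∀ {x y} → Triangle x → Triangle y → x ≢ y → Adj G x y
    adjacent (inj₁ refl)        (inj₁ refl)        x≢y = ⊥-elim (x≢y refl)
    adjacent (inj₁ refl)        (inj₂ (inj₁ refl)) _   = ab
    adjacent (inj₁ refl)        (inj₂ (inj₂ refl)) _   = ad
    adjacent (inj₂ (inj₁ refl)) (inj₁ refl)        _   = sym G ab
    adjacent (inj₂ (inj₁ refl)) (inj₂ (inj₁ refl)) x≢y = ⊥-elim (x≢y refl)
    adjacent (inj₂ (inj₁ refl)) (inj₂ (inj₂ refl)) _   = bd
    adjacent (inj₂ (inj₂ refl)) (inj₁ refl)        _   = sym G ad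
    adjacent (inj₂ (inj₂ refl)) (inj₂ (inj₁ refl)) _   = sym G bd
    adjacent (inj₂ (inj₂ refl)) (inj₂ (inj₂ refl)) x≢y = ⊥-elim (x≢y refl)

  Merged⇒SamePair : Merged G (i , j) (a , b) → SamePair i j a b
  Merged⇒SamePair (inj₁ refl)              = inj₁ (refl , refl)
  Merged⇒SamePair (inj₂ (_ , refl , refl)) = inj₂ (refl , refl)

  SamePair⇒Merged : Adj G i j → SamePair i j a b → Merged G (i , j) (a , b)
  SamePair⇒Merged _  (inj₁ (refl , refl)) = inj₁ refl
  SamePair⇒Merged ij (inj₂ (refl , refl)) = inj₂ (ij , refl , refl)

  sharedVertex⇒triangle : Adj G i j → Adj G l k → SamePair i j a b → SamePair l k a d
                         → Adj G b d → MeetInOne i j l k × InducedComplete G i j l k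
  sharedVertex⇒triangle ij lk p q bd =
    MeetInOne-resp-SamePair p q (MeetInOne-shared (Adj⇒≢ bd)) ,
    InducedComplete-resp-SamePair p q
      (InducedComplete-triangle (Adj-resp-SamePair p ij) (Adj-resp-SamePair q lk) bd)

  GasketAdj⇒triangle : Adj G i j → Adj G l k → ¬ SamePair i j l k
                     → GasketAdj G (contracted i j) (contracted l k)
                     → MeetInOne i j l k × InducedComplete G i j l k
  GasketAdj⇒triangle ij lk _ (_ , _ , _ , mu , mv , inj₁ (refl , bd)) =
    sharedVertex⇒triangle ij lk (Merged⇒SamePair mu) (Merged⇒SamePair mv) bd
  GasketAdj⇒triangle _ _ distinct (_ , _ , _ , mu , mv , inj₂ (_ , _ , refl , refl)) =
    ⊥-elim (distinct (SamePair-trans (Merged⇒SamePair mu)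
                       (SamePair-trans SamePair-swap (SamePair-sym (Merged⇒SamePair mv)))))

  triangle⇒GasketAdj : Adj G i j → Adj G l k → ¬ SamePair i j l k
                     → MeetInOne i j l k × InducedComplete G i j l k
                     → GasketAdj G (contracted i j) (contracted l k)
  triangle⇒GasketAdj {i = i} {j = j} {l = l} {k = k} ij lk distinct
                     ((c , c∈ij , c∈lk , unique) , complete)
    with ∈₂⇒SamePair c∈ij | ∈₂⇒SamePair c∈lk
  ... | b , p | d , q =
    distinct ∘ Merged⇒SamePair ,
    (c , b) , (c , d) , SamePair⇒Merged ij p , SamePair⇒Merged lk q ,
    inj₁ (refl , complete b d (In4-join (inj₁ b∈ij)) (In4-join (inj₂ d∈lk)) b≢d)
    where
    b∈ij : b ∈₂ i , j
    b∈ij = ∈₂-resp-SamePair p (inj₂ refl)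
    d∈lk : d ∈₂ l , k
    d∈lk = ∈₂-resp-SamePair q (inj₂ refl)
    b≢d : b ≢ d
    b≢d refl = Adj⇒≢ (Adj-resp-SamePair p ij) (≡.sym (unique b b∈ij d∈lk))

mainTheorem9 : (n : ℕ) → 2 ≤ n → (G : SimpleGraph n) → (i j l k : Fin n)
    → Adj G i j → Adj G l k → ¬ SamePair i j l k
    → GasketAdj G (contracted i j) (contracted l k)
      ⇔ (MeetInOne i j l k × InducedComplete G i j l k)
mainTheorem9 _ _ G _ _ _ _ ij lk distinct =
  mk⇔ (GasketAdj⇒triangle G ij lk distinct) (triangle⇒GasketAdj G ij lk distinct)
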